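{- Let $P$ be a finite poset with $|P|\ge2$ whose Hasse diagram is connected, and let $P^*$ be its order dual. Then $U_P$ is Gorenstein (respectively $\mathbb{Q}$-Gorenstein) if and only if $U_{P^*}$ is Gorenstein (respectively $\mathbb{Q}$-Gorenstein). Moreover, $X_P\dashrightarrow U_P$ is crepant if and only if $X_{P^*}\dashrightarrow U_{P^*}$ is crepant.
   Context: Identify $P$ with $[n]$; $N=\mathbb{Z}^n/\mathbb{Z}(1,\dots,1)$, $N_{\mathbb{R}}=N\otimes\mathbb{R}$, $M$ the dual lattice. For a poset $Q$ on $[n]$, the braid cone is $\sigma_Q=\{x\in N_{\mathbb{R}}: x_i\le x_j\text{ whenever } i<_Q j\}$, $U_Q$ its affine toric variety; $\Sigma_Q$ is the fan of the cones $\sigma_L$ for all linear extensions $L$ of $Q$ and their faces, and $X_Q$ its toric variety. $U_Q$ is $\mathbb{Q}$-Gorenstein of index $r$ if $r$ is the least positive integer such that some $u\in M$ satisfies $\langle u,v\rangle=r$ for all ray generators $v$ of $\sigma_Q$, and Gorenstein if the index is $1$. $X_Q\dashrightarrow U_Q$ is crepant if $U_Q$ is $\mathbb{Q}$-Gorenstein and such a $u$ also satisfies $\langle u,v\rangle=r$ for all ray generators $v$ of $\Sigma_Q$. -}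

module Defs where

open import Level using (0ℓ)
open import Data.Nat as ℕ using (ℕ; zero; suc)
open import Data.Integer as ℤ using (ℤ; +_; _+_; _*_; _-_)
open import Data.Fin as Fin using (Fin)
open import Data.Fin.Permutation using (Permutation′; _⟨$⟩ʳ_)
open import Data.Product using (Σ; _×_; ∃; ∃-syntax)
open import Data.Sum using (_⊎_)
open import Relation.Binary.PropositionalEquality using (_≡_)
open import Relation.Nullary using (¬_)

-- A relation on the ground set [n] = Fin n (intended: the strict order <_Q).
BinRel : ℕ → Set₁
BinRel n = Fin n → Fin n → Set

dual : ∀ {n} → BinRel n → BinRel n
dual R i j = R j i

Covers : ∀ {n} → BinRel n → BinRel n
Covers R i j = R i j × (¬ (∃[ k ] (R i k × R k j)))

HasseEdge : ∀ {n} → BinRel n → BinRel n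
HasseEdge R i j = Covers R i j ⊎ Covers R j i

data HassePath {n} (R : BinRel n) : Fin n → Fin n → Set where
  here : ∀ {i} → HassePath R i i
  step : ∀ {i j k} → HasseEdge R i j → HassePath R j k → HassePath R i k

HasseConnected : ∀ {n} → BinRel n → Set
HasseConnected {n} R = ∀ (i j : Fin n) → HassePath R i j

-- N = ℤ^n / ℤ(1,…,1): an element of N is represented by any
-- x : Fin n → ℤ; two representatives are equal in N iff they differ by a
-- constant vector.  M = { u ∈ ℤ^n | Σ u_i = 0 } is the dual lattice and
-- ⟨u , x⟩ = Σ u_i x_i is the (well-defined) pairing.

Vecℤ : ℕ → Set
Vecℤ n = Fin n → ℤ

sumℤ : ∀ {n} → Vecℤ n → ℤ
sumℤ {zero}  x = + 0
sumℤ {suc n} x = x Fin.zero + sumℤ (λ i → x (Fin.suc i))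

_≈N_ : ∀ {n} → Vecℤ n → Vecℤ n → Set
_≈N_ {n} x y = Σ ℤ λ c → ∀ (i : Fin n) → x i ≡ y i + c

zeroN : ∀ {n} → Vecℤ n
zeroN _ = + 0

_+N_ : ∀ {n} → Vecℤ n → Vecℤ n → Vecℤ n
(x +N y) i = x i + y i

_·N_ : ∀ {n} → ℤ → Vecℤ n → Vecℤ n
(k ·N x) i = k * x i

InM : ∀ {n} → Vecℤ n → Set
InM u = sumℤ u ≡ + 0

⟨_,_⟩ : ∀ {n} → Vecℤ n → Vecℤ n → ℤ
⟨ u , x ⟩ = sumℤ (λ i → u i * x i)

-- Cones (given by their sets of lattice points; all cones here are
-- rational polyhedral, so rays can be detected on lattice points).

Cone : ℕ → Set₁
Cone n = Vecℤ n → Set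

braidCone : ∀ {n} → BinRel n → Cone n
braidCone {n} R x = ∀ (i j : Fin n) → R i j → x i ℤ.≤ x j

OnRay : ∀ {n} → Vecℤ n → Vecℤ n → Set
OnRay v y = Σ ℕ λ p → Σ ℕ λ q → ((+ suc p) ·N y) ≈N ((+ q) ·N v)

PrimitiveN : ∀ {n} → Vecℤ n → Set
PrimitiveN v = ¬ (Σ ℕ λ k → Σ (Vecℤ _) λ w → v ≈N ((+ (suc (suc k))) ·N w))

IsRayGen : ∀ {n} → Cone n → Vecℤ n → Set
IsRayGen C v =
  C v × ¬ (v ≈N zeroN) × PrimitiveN v ×
  (∀ a b → C a → C b → OnRay v (a +N b) → OnRay v a × OnRay v b)

-- linear extensions of Q, encoded by a bijection π : [n] → [n] (position
-- in the total order);  the total order is  i <_L j  iff  π i < π j.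
IsLinearExtension : ∀ {n} → BinRel n → Permutation′ n → Set
IsLinearExtension {n} R π = ∀ (i j : Fin n) → R i j → (π ⟨$⟩ʳ i) Fin.< (π ⟨$⟩ʳ j)

linOrder : ∀ {n} → Permutation′ n → BinRel n
linOrder π i j = (π ⟨$⟩ʳ i) Fin.< (π ⟨$⟩ʳ j)

-- ray generators of the fan Σ_Q: ray generators of some σ_L, L a linear
-- extension (faces of the σ_L contribute no further rays).
IsFanRayGen : ∀ {n} → BinRel n → Vecℤ n → Set
IsFanRayGen R v = Σ (Permutation′ _) λ π →
  IsLinearExtension R π × IsRayGen (braidCone (linOrder π)) v

Witness : ∀ {n} → BinRel n → ℕ → Vecℤ n → Set
Witness R r u = InM u × (∀ v → IsRayGen (braidCone R) v → ⟨ u , v ⟩ ≡ + r)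

Admissible : ∀ {n} → BinRel n → ℕ → Set
Admissible {n} R r = 1 ℕ.≤ r × Σ (Vecℤ n) (Witness R r)

-- U_Q is ℚ-Gorenstein of index r: r is the least positive admissible integer
HasIndex : ∀ {n} → BinRel n → ℕ → Set
HasIndex R r = Admissible R r × (∀ r′ → Admissible R r′ → r ℕ.≤ r′)

QGorenstein : ∀ {n} → BinRel n → Set
QGorenstein R = Σ ℕ (HasIndex R)

Gorenstein : ∀ {n} → BinRel n → Set
Gorenstein R = HasIndex R 1

-- X_Q ⇢ U_Q is crepant: U_Q is ℚ-Gorenstein of index r and some u ∈ M
-- witnessing the index also takes value r on all ray generators of Σ_Q.
Crepant : ∀ {n} → BinRel n → Set
Crepant {n} R = Σ ℕ λ r → HasIndex R r × Σ (Vecℤ n) λ u →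
  Witness R r u × (∀ v → IsFanRayGen R v → ⟨ u , v ⟩ ≡ + r)

{-# OPTIONS --safe #-}
module Submission where

open import Defs
open import Data.Nat using (ℕ; _≤_)
open import Data.Fin using (Fin)
open import Data.Product using (_×_)
open import Relation.Binary.PropositionalEquality using (_≡_)
open import Relation.Binary.Structures using (IsStrictPartialOrder)
open import Function.Bundles using (_⇔_)

open import Data.Nat as ℕ using (suc)
import Data.Nat.Properties as ℕ
open import Data.Integer as ℤ using (+_; -_; _+_; _*_)
import Data.Integer.Properties as ℤ
import Data.Fin as Fin
import Data.Fin.Properties as Fin
open import Data.Fin.Permutation using (Permutation′; _∘ₚ_; reverse)
open import Data.Product using (_,_)
open import Function.Base using (id)
open import Relation.Binary.PropositionalEquality
  using (_≗_; refl; sym; trans; cong; cong₂; subst₂)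
open import Function.Bundles using (mk⇔)

-- The map x ↦ -x is an automorphism of N carrying σ_P onto σ_{P*}, and, since
-- reversing a linear extension of P gives one of P*, carrying the fan Σ_P onto
-- Σ_{P*}. Its transpose u ↦ -u on M therefore turns every u witnessing the
-- index (or crepancy) of P into one for P*, with the same r; as P** = P this
-- gives all three equivalences.

neg : ∀ {n} → Vecℤ n → Vecℤ n
neg x i = - x i

neg-involutive : ∀ {n} (x : Vecℤ n) → neg (neg x) ≗ x
neg-involutive x i = ℤ.neg-involutive (x i)

neg-distrib-+N : ∀ {n} (x y : Vecℤ n) → neg (x +N y) ≗ neg x +N neg y
neg-distrib-+N x y i = ℤ.neg-distrib-+ (x i) (y i)

neg-distrib-·N : ∀ {n} k (x : Vecℤ n) → neg (k ·N x) ≗ k ·N neg x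
neg-distrib-·N k x i = ℤ.neg-distribʳ-* k (x i)

·N-cong : ∀ {n} k {x y : Vecℤ n} → x ≗ y → k ·N x ≗ k ·N y
·N-cong k x≗y i = cong (k *_) (x≗y i)

sumℤ-cong : ∀ {n} {x y : Vecℤ n} → x ≗ y → sumℤ x ≡ sumℤ y
sumℤ-cong {ℕ.zero} x≗y = refl
sumℤ-cong {suc n}  x≗y = cong₂ _+_ (x≗y Fin.zero) (sumℤ-cong (λ i → x≗y (Fin.suc i)))

sumℤ-neg : ∀ {n} (x : Vecℤ n) → sumℤ (neg x) ≡ - sumℤ x
sumℤ-neg {ℕ.zero} x = refl
sumℤ-neg {suc n}  x =
  trans (cong (λ s → - x Fin.zero + s) (sumℤ-neg (λ i → x (Fin.suc i))))
        (sym (ℤ.neg-distrib-+ (x Fin.zero) _))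

InM-neg : ∀ {n} {u : Vecℤ n} → InM u → InM (neg u)
InM-neg {u = u} Σu≡0 = trans (sumℤ-neg u) (cong -_ Σu≡0)

⟨neg,⟩≡⟨,neg⟩ : ∀ {n} (u v : Vecℤ n) → ⟨ neg u , v ⟩ ≡ ⟨ u , neg v ⟩
⟨neg,⟩≡⟨,neg⟩ u v = sumℤ-cong λ i →
  trans (sym (ℤ.neg-distribˡ-* (u i) (v i))) (ℤ.neg-distribʳ-* (u i) (v i))

≈N-resp-≗ : ∀ {n} {x x′ y y′ : Vecℤ n} → x ≗ x′ → y ≗ y′ → x ≈N y → x′ ≈N y′
≈N-resp-≗ x≗x′ y≗y′ (c , x≡y+c) =
  c , λ i → trans (sym (x≗x′ i)) (trans (x≡y+c i) (cong (_+ c) (y≗y′ i)))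

≈N-neg : ∀ {n} {x y : Vecℤ n} → x ≈N y → neg x ≈N neg y
≈N-neg {y = y} (c , x≡y+c) =
  - c , λ i → trans (cong -_ (x≡y+c i)) (ℤ.neg-distrib-+ (y i) c)

≈N-neg⁻ : ∀ {n} {x y : Vecℤ n} → neg x ≈N y → x ≈N neg y
≈N-neg⁻ {x = x} {y} eq =
  ≈N-resp-≗ {y = neg y} (neg-involutive x) (λ _ → refl) (≈N-neg {y = y} eq)

OnRay-resp-≗ : ∀ {n} {v v′ y y′ : Vecℤ n} → v ≗ v′ → y ≗ y′ → OnRay v y → OnRay v′ y′
OnRay-resp-≗ v≗v′ y≗y′ (p , q , eq) =
  p , q , ≈N-resp-≗ (·N-cong (+ suc p) y≗y′) (·N-cong (+ q) v≗v′) eq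

OnRay-neg : ∀ {n} {v y : Vecℤ n} → OnRay v y → OnRay (neg v) (neg y)
OnRay-neg {v = v} {y} (p , q , eq) =
  p , q , ≈N-resp-≗ (neg-distrib-·N (+ suc p) y) (neg-distrib-·N (+ q) v)
                    (≈N-neg {y = (+ q) ·N v} eq)

OnRay-neg⁻ : ∀ {n} {v y : Vecℤ n} → OnRay v (neg y) → OnRay (neg v) y
OnRay-neg⁻ {v = v} {y} onRay =
  OnRay-resp-≗ (λ _ → refl) (neg-involutive y) (OnRay-neg {v = v} onRay)

PrimitiveN-neg : ∀ {n} {v : Vecℤ n} → PrimitiveN v → PrimitiveN (neg v)
PrimitiveN-neg {v = v} prim (k , w , eq) =
  prim (k , neg w , ≈N-resp-≗ (λ _ → refl) (neg-distrib-·N (+ suc (suc k)) w)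
                               (≈N-neg⁻ {x = v} {(+ suc (suc k)) ·N w} eq))

IsRayGen-neg : ∀ {n} {C D : Cone n} →
  (∀ x → C x → D (neg x)) → (∀ y → D y → C (neg y)) →
  ∀ v → IsRayGen C v → IsRayGen D (neg v)
IsRayGen-neg {D = D} C⇒D D⇒C v (Cv , v≉0 , prim , extremal) =
  C⇒D v Cv , (λ -v≈0 → v≉0 (≈N-neg⁻ {y = zeroN} -v≈0)) , PrimitiveN-neg prim , extremal′
  where
  extremal′ : ∀ a b → D a → D b → OnRay (neg v) (a +N b) → OnRay (neg v) a × OnRay (neg v) b
  extremal′ a b Da Db onRay
    with extremal (neg a) (neg b) (D⇒C a Da) (D⇒C b Db)
           (OnRay-resp-≗ (neg-involutive v) (neg-distrib-+N a b) (OnRay-neg onRay))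
  ... | onRayᵃ , onRayᵇ = OnRay-neg⁻ onRayᵃ , OnRay-neg⁻ onRayᵇ

braidCone-neg : ∀ {n} {R S : BinRel n} → (∀ {i j} → S i j → R j i) →
  ∀ x → braidCone R x → braidCone S (neg x)
braidCone-neg S⇒R˘ x x∈σR i j Sij = ℤ.neg-mono-≤ (x∈σR j i (S⇒R˘ Sij))

IsRayGen-braidCone-neg : ∀ {n} {R S : BinRel n} →
  (∀ {i j} → S i j → R j i) → (∀ {i j} → R i j → S j i) →
  ∀ v → IsRayGen (braidCone R) v → IsRayGen (braidCone S) (neg v)
IsRayGen-braidCone-neg S⇒R˘ R⇒S˘ = IsRayGen-neg (braidCone-neg S⇒R˘) (braidCone-neg R⇒S˘)

opposite-mono-< : ∀ {n} {i j : Fin n} → i Fin.< j → Fin.opposite j Fin.< Fin.opposite i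
opposite-mono-< {n} {i} {j} i<j =
  subst₂ ℕ._<_ (sym (Fin.opposite-prop j)) (sym (Fin.opposite-prop i))
    (ℕ.∸-monoʳ-< {n} (ℕ.s≤s i<j) (Fin.toℕ<n j))

opposite-cancel-< : ∀ {n} {i j : Fin n} → Fin.opposite i Fin.< Fin.opposite j → j Fin.< i
opposite-cancel-< {i = i} {j} opp<opp =
  subst₂ Fin._<_ (Fin.opposite-involutive j) (Fin.opposite-involutive i)
    (opposite-mono-< opp<opp)

IsLinearExtension-reverse : ∀ {n} {R : BinRel n} {π : Permutation′ n} →
  IsLinearExtension (dual R) π → IsLinearExtension R (π ∘ₚ reverse)
IsLinearExtension-reverse ext i j Rij = opposite-mono-< (ext j i Rij)

IsFanRayGen-dual : ∀ {n} (R : BinRel n) v → IsFanRayGen (dual R) v → IsFanRayGen R (neg v)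
IsFanRayGen-dual R v (π , ext , rayGen) =
  π ∘ₚ reverse , IsLinearExtension-reverse {R = R} {π} ext ,
  IsRayGen-braidCone-neg opposite-cancel-< opposite-mono-< v rayGen

IsRayGen-dual : ∀ {n} (R : BinRel n) v →
  IsRayGen (braidCone (dual R)) v → IsRayGen (braidCone R) (neg v)
IsRayGen-dual R = IsRayGen-braidCone-neg id id

Witness-dual : ∀ {n} (R : BinRel n) {r u} → Witness R r u → Witness (dual R) r (neg u)
Witness-dual R {u = u} (u∈M , u≡r) =
  InM-neg {u = u} u∈M ,
  λ v rayGen → trans (⟨neg,⟩≡⟨,neg⟩ u v) (u≡r (neg v) (IsRayGen-dual R v rayGen))

Admissible-dual : ∀ {n} (R : BinRel n) {r} → Admissible R r → Admissible (dual R) r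
Admissible-dual R (1≤r , u , witness) = 1≤r , neg u , Witness-dual R witness

HasIndex-dual : ∀ {n} (R : BinRel n) {r} → HasIndex R r → HasIndex (dual R) r
HasIndex-dual R (admissible , least) =
  Admissible-dual R admissible , λ r′ admissible′ → least r′ (Admissible-dual (dual R) admissible′)

QGorenstein-dual : ∀ {n} (R : BinRel n) → QGorenstein R → QGorenstein (dual R)
QGorenstein-dual R (r , index) = r , HasIndex-dual R index

Crepant-dual : ∀ {n} (R : BinRel n) → Crepant R → Crepant (dual R)
Crepant-dual R (r , index , u , witness , u≡r) =
  r , HasIndex-dual R index , neg u , Witness-dual R witness ,
  λ v fanRayGen → trans (⟨neg,⟩≡⟨,neg⟩ u v) (u≡r (neg v) (IsFanRayGen-dual R v fanRayGen))

proposition3p2 : (n : ℕ) → 2 ≤ n → (_<P_ : Fin n → Fin n → Set) →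
    IsStrictPartialOrder _≡_ _<P_ → HasseConnected _<P_ →
    (Gorenstein _<P_ ⇔ Gorenstein (dual _<P_)) ×
    (QGorenstein _<P_ ⇔ QGorenstein (dual _<P_)) ×
    (Crepant _<P_ ⇔ Crepant (dual _<P_))
-- The duality holds for every relation.
proposition3p2 n _ R _ _ =
  mk⇔ (HasIndex-dual R) (HasIndex-dual (dual R)) ,
  mk⇔ (QGorenstein-dual R) (QGorenstein-dual (dual R)) ,
  mk⇔ (Crepant-dual R) (Crepant-dual (dual R))
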